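{- Let $n\ge 1$ and consider the U-MMB with $n$ leaves. (1) The number of mountains is $t=\lfloor\log_2(n+1)\rfloor$. (2) If $n+1$ in binary is $(b_t\cdots b_1b_0)$ and the mountain heights are enumerated from right to left starting from zero, $S_n=(s_{t-1},\dots,s_1,s_0)$, then $s_i=b_i+i$ for each $0\le i<t$. (3) During the $n$-th append (which produces the structure with $n$ leaves), the merge step is skipped if and only if $n+1$ is a power of two; otherwise, if $j$ is the index of the lowest 1-bit of $n+1$, two mountains of height $j$ are merged, and the new mountain is at position $j$ and has height $s_j=j+1$. (4) Heights in $S_n$ are weakly decreasing from left to right, so mountains of equal height are always consecutive (hence mergeable); there are 0, 1 or 2 mountains of any given height; and the height difference between consecutive mountains is 0, 1 or 2.
   Context: A mountain of height $s\ge0$ is a perfect binary tree with $2^s$ leaves; its root is its peak. The U-MMB with $n$ leaves is an ordered (left-to-right) list of mountains whose leaves read left to right are $h_1,\dots,h_n$, defined inductively from the empty list: the $n$-th append (1) adds the leaf $h_n$ as a height-0 mountain at the right end of the list, and (2) if there exist two consecutive mountains of equal height (a mergeable pair), takes the rightmost such pair, of height $s$, and replaces it in place by a single mountain of height $s+1$ whose new peak has the two old peaks as children (the merge step); otherwise no merge is performed. $S_n$ is the list of mountain heights. -}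

module Defs where

open import Data.Nat using (ℕ; zero; suc; _+_; _≤_; _^_; _/_; _%_)
open import Data.Nat.Properties using (_≟_)
open import Data.List using (List; []; _∷_; _∷ʳ_; length; reverse)
open import Data.Maybe using (Maybe; just; nothing)
open import Data.Product using (_×_; _,_; ∃)
open import Relation.Binary.PropositionalEquality using (_≡_)
open import Relation.Nullary using (yes; no)

-- A U-MMB is represented by its list of mountain heights, read LEFT TO RIGHT
-- (the heights evolve independently of the leaf contents h_1, ..., h_n).

-- Result of a merge step: (index of the new mountain counted from the right
-- starting at 0, height s of the merged pair, new list of heights).
MergeInfo : Set
MergeInfo = ℕ × ℕ × List ℕ

mergeRightmost : List ℕ → Maybe MergeInfo
mergeHere : ℕ → List ℕ → Maybe MergeInfo → Maybe MergeInfo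

mergeRightmost []       = nothing
mergeRightmost (x ∷ xs) = mergeHere x xs (mergeRightmost xs)

-- third argument: result of merging inside the tail (a pair further right)
mergeHere x xs (just (p , s , ys)) = just (p , s , x ∷ ys)
mergeHere x []       nothing = nothing
mergeHere x (y ∷ zs) nothing with x ≟ y
... | yes _ = just (length zs , x , suc x ∷ zs)
... | no  _ = nothing

appendMerge : List ℕ → Maybe MergeInfo
appendMerge L = mergeRightmost (L ∷ʳ 0)

resultOf : List ℕ → Maybe MergeInfo → List ℕ
resultOf L (just (_ , _ , ys)) = ys
resultOf L nothing             = L ∷ʳ 0

append : List ℕ → List ℕ
append L = resultOf L (appendMerge L)

S : ℕ → List ℕ
S zero    = []
S (suc n) = append (S n)

-- merge information of the n-th append (the one producing S n), n ≥ 1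
nthAppendMerge : ℕ → Maybe MergeInfo
nthAppendMerge zero    = nothing
nthAppendMerge (suc n) = appendMerge (S n)

bit : ℕ → ℕ → ℕ
bit m zero    = m % 2
bit m (suc i) = bit (m / 2) i

IsPowerOfTwo : ℕ → Set
IsPowerOfTwo m = ∃ λ k → m ≡ 2 ^ k

LowestOneBit : ℕ → ℕ → Set
LowestOneBit m j = bit m j ≡ 1 × (∀ i → suc i ≤ j → bit m i ≡ 0)

nth : List ℕ → ℕ → Maybe ℕ
nth []       _       = nothing
nth (x ∷ xs) zero    = just x
nth (x ∷ xs) (suc i) = nth xs i

countEq : ℕ → List ℕ → ℕ
countEq h []       = 0
countEq h (x ∷ xs) with x ≟ h
... | yes _ = suc (countEq h xs)
... | no  _ = countEq h xs

{-# OPTIONS --safe #-}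
-- Write m = n + 1 and call the list of heights b_{t-1} + (t - 1), ..., b_0 + 0 built from the binary
-- digits b_i of m its staircase. The staircases of 2k and 2k + 1 arise from that of k by raising
-- every height by one and appending a 0, resp. a 1, at the right. Appending a leaf to the staircase
-- of 2k creates two trailing 0s, which merge into the staircase of 2k + 1. Appending a leaf to the
-- staircase of 2k + 1 yields the staircase of k followed by a 0, raised by one, followed by a new 0;
-- as that new 0 merges with no raised height, this is the append to the staircase of k one
-- level up. Induction on the binary expansion of m therefore shows that appending a leaf turns the
-- staircase of m into that of m + 1, merging at height and position the lowest one bit of m + 1,
-- and not merging at all when m + 1 is a power of two. The shape properties (4) hold for every
-- staircase whose digits are at most 1.
module Submission where

open import Defs
open import Data.Nat.Base
  using (ℕ; zero; suc; _+_; _*_; _∸_; _^_; _/_; _%_; _≤_; _≥_; _<_; z≤n; s≤s; ⌊_/2⌋; NonZero)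
open import Data.Nat.Properties
  using (_≟_; suc-injective; +-suc; +-comm; +-identityʳ; *-comm; *-suc; *-cancelˡ-≡; m*n≢0; ≤-refl; ≤-pred; ≤-trans; ≤-reflexive; +-mono-≤; +-monoˡ-≤; m≤n+m; m+[n∸m]≡n; n≡⌈n+n/2⌉; <-cmp; 0≢1+n)
open import Data.Nat.DivMod using (m*n/n≡m; m*n%n≡0; [m+kn]%n≡m%n; +-distrib-/; m%n<n)
open import Data.Nat.Logarithm using (⌊log₂_⌋; ⌊log₂⌊n/2⌋⌋≡⌊log₂n⌋∸1; ⌊log₂[2*b]⌋≡1+⌊log₂b⌋; ⌊log₂⌋-mono-≤)
open import Data.List using (List; []; _∷_; [_]; _∷ʳ_; _++_; map; length; reverse; applyUpTo; applyDownFrom)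
open import Data.List.Properties
  using (map-++; length-++; length-map; unfold-reverse; length-reverse; length-applyDownFrom; applyDownFrom-∷ʳ; map-applyDownFrom; reverse-applyDownFrom)
open import Data.List.Relation.Unary.Linked as Linked using (Linked)
open import Data.List.Relation.Unary.Linked.Properties using (applyDownFrom⁺₂)
open import Data.Maybe as Maybe using (just; nothing)
open import Data.Product using (_×_; _,_; proj₁)
open import Function.Base using (_∘_)
open import Function.Bundles using (_⇔_; mk⇔)
open import Relation.Binary.Definitions using (tri<; tri≈; tri>)
open import Relation.Binary.PropositionalEquality
  using (_≡_; _≢_; refl; sym; trans; cong; cong₂; subst; module ≡-Reasoning)
open import Relation.Nullary using (¬_; yes; no; contradiction)

open ≡-Reasoning

[2*k]%2≡0 : ∀ k → 2 * k % 2 ≡ 0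
[2*k]%2≡0 k = trans (cong (_% 2) (*-comm 2 k)) (m*n%n≡0 k 2)

[1+2*k]%2≡1 : ∀ k → (1 + 2 * k) % 2 ≡ 1
[1+2*k]%2≡1 k = trans (cong (λ x → (1 + x) % 2) (*-comm 2 k)) ([m+kn]%n≡m%n 1 k 2)

[2*k]/2≡k : ∀ k → 2 * k / 2 ≡ k
[2*k]/2≡k k = trans (cong (_/ 2) (*-comm 2 k)) (m*n/n≡m k 2)

[1+2*k]/2≡k : ∀ k → (1 + 2 * k) / 2 ≡ k
[1+2*k]/2≡k k = begin
  (1 + 2 * k) / 2        ≡⟨ +-distrib-/ 1 (2 * k) (subst (λ r → 1 + r < 2) (sym ([2*k]%2≡0 k)) ≤-refl) ⟩
  1 / 2 + 2 * k / 2      ≡⟨ [2*k]/2≡k k ⟩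
  k                      ∎

1+2*a≢2*b : ∀ a b → 1 + 2 * a ≢ 2 * b
1+2*a≢2*b a b eq = 0≢1+n (begin
  0               ≡⟨ sym ([2*k]%2≡0 b) ⟩
  2 * b % 2       ≡⟨ cong (_% 2) (sym eq) ⟩
  (1 + 2 * a) % 2 ≡⟨ [1+2*k]%2≡1 a ⟩
  1               ∎)

⌊[1+2*k]/2⌋≡k : ∀ k → ⌊ 1 + 2 * k /2⌋ ≡ k
⌊[1+2*k]/2⌋≡k k = sym (trans (n≡⌈n+n/2⌉ k) (cong (λ x → ⌊ suc (k + x) /2⌋) (sym (+-identityʳ k))))

⌊log₂[1+2*k]⌋≡1+⌊log₂k⌋ : ∀ k .{{_ : NonZero k}} → ⌊log₂ (1 + 2 * k) ⌋ ≡ 1 + ⌊log₂ k ⌋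
⌊log₂[1+2*k]⌋≡1+⌊log₂k⌋ k@(suc _) = begin
  ⌊log₂ (1 + 2 * k) ⌋               ≡⟨ sym (m+[n∸m]≡n (⌊log₂⌋-mono-≤ {2} {1 + 2 * k} (s≤s (s≤s z≤n)))) ⟩
  1 + (⌊log₂ (1 + 2 * k) ⌋ ∸ 1)     ≡⟨ cong suc (sym (⌊log₂⌊n/2⌋⌋≡⌊log₂n⌋∸1 (1 + 2 * k))) ⟩
  1 + ⌊log₂ ⌊ 1 + 2 * k /2⌋ ⌋       ≡⟨ cong (λ x → 1 + ⌊log₂ x ⌋) (⌊[1+2*k]/2⌋≡k k) ⟩
  1 + ⌊log₂ k ⌋                     ∎

bit≤1 : ∀ m i → bit m i ≤ 1
bit≤1 m zero    = ≤-pred (m%n<n m 2)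
bit≤1 m (suc i) = bit≤1 (m / 2) i

isPowerOfTwo-2* : ∀ {k} → IsPowerOfTwo k → IsPowerOfTwo (2 * k)
isPowerOfTwo-2* (e , refl) = suc e , refl

isPowerOfTwo-2*⁻¹ : ∀ {k} → IsPowerOfTwo (2 * k) → IsPowerOfTwo k
isPowerOfTwo-2*⁻¹ {k} (zero  , eq) = contradiction (sym eq) (1+2*a≢2*b 0 k)
isPowerOfTwo-2*⁻¹ {k} (suc e , eq) = e , *-cancelˡ-≡ k (2 ^ e) 2 eq

¬isPowerOfTwo-1+2* : ∀ k .{{_ : NonZero k}} → ¬ IsPowerOfTwo (1 + 2 * k)
¬isPowerOfTwo-1+2* (suc _) (zero  , ())
¬isPowerOfTwo-1+2* k       (suc e , eq) = 1+2*a≢2*b k (2 ^ e) eq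

lowestOneBit-1+2* : ∀ k → LowestOneBit (1 + 2 * k) 0
lowestOneBit-1+2* k = [1+2*k]%2≡1 k , λ _ ()

lowestOneBit-2* : ∀ {k j} → LowestOneBit k j → LowestOneBit (2 * k) (suc j)
lowestOneBit-2* {k} {j} (one , zeros) = halve (λ x → bit x j ≡ 1) one , below
  where
  halve : ∀ (P : ℕ → Set) → P k → P (2 * k / 2)
  halve P = subst P (sym ([2*k]/2≡k k))
  below : ∀ i → suc i ≤ suc j → bit (2 * k) i ≡ 0
  below zero    _         = [2*k]%2≡0 k
  below (suc i) (s≤s i<j) = halve (λ x → bit x i ≡ 0) (zeros i i<j)

lowestOneBit-unique : ∀ {m i j} → LowestOneBit m i → LowestOneBit m j → i ≡ j
lowestOneBit-unique {i = i} {j} (oneᵢ , zerosᵢ) (oneⱼ , zerosⱼ) with <-cmp i j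
... | tri< i<j _ _ = contradiction (trans (sym (zerosⱼ i i<j)) oneᵢ) (λ ())
... | tri≈ _ i≡j _ = i≡j
... | tri> _ _ j<i = contradiction (trans (sym (zerosᵢ j j<i)) oneⱼ) (λ ())

data Positive : ℕ → Set where
  one  : Positive 1
  even : ∀ {k} → Positive k → Positive (2 * k)
  odd  : ∀ {k} → Positive k → Positive (1 + 2 * k)

positive⇒nonZero : ∀ {k} → Positive k → NonZero k
positive⇒nonZero one      = _
positive⇒nonZero (even p) = m*n≢0 2 _ {{_}} {{positive⇒nonZero p}}
positive⇒nonZero (odd p)  = _

suc-positive : ∀ {m} → Positive m → Positive (suc m)
suc-positive one              = even one
suc-positive (even p)         = odd p
suc-positive (odd {k} p)      = subst Positive (*-suc 2 k) (even (suc-positive p))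

positive : ∀ n → Positive (suc n)
positive zero    = one
positive (suc n) = suc-positive (positive n)

applyDownFrom-cong : ∀ {f g : ℕ → ℕ} → (∀ i → f i ≡ g i) → ∀ t → applyDownFrom f t ≡ applyDownFrom g t
applyDownFrom-cong f≗g zero    = refl
applyDownFrom-cong f≗g (suc t) = cong₂ _∷_ (f≗g t) (applyDownFrom-cong f≗g t)

staircase : (ℕ → ℕ) → ℕ → List ℕ
staircase c t = applyDownFrom (λ i → c i + i) t

staircase-suc : ∀ c t → staircase c (suc t) ≡ map suc (staircase (c ∘ suc) t) ∷ʳ c 0
staircase-suc c t = begin
  staircase c (suc t)
    ≡⟨ sym (applyDownFrom-∷ʳ (λ i → c i + i) t) ⟩
  applyDownFrom (λ i → c (suc i) + suc i) t ∷ʳ (c 0 + 0)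
    ≡⟨ cong₂ _∷ʳ_ (applyDownFrom-cong (λ i → +-suc (c (suc i)) i) t) (+-identityʳ (c 0)) ⟩
  applyDownFrom (λ i → suc (c (suc i) + i)) t ∷ʳ c 0
    ≡⟨ cong (_∷ʳ c 0) (sym (map-applyDownFrom (λ i → c (suc i) + i) suc t)) ⟩
  map suc (staircase (c ∘ suc) t) ∷ʳ c 0
    ∎

heights : ℕ → List ℕ
heights m = staircase (bit m) ⌊log₂ m ⌋

raise : List ℕ → List ℕ
raise xs = map suc xs ∷ʳ 0

heights-half : ∀ m k → m / 2 ≡ k → ⌊log₂ m ⌋ ≡ 1 + ⌊log₂ k ⌋ →
               heights m ≡ map suc (heights k) ∷ʳ m % 2
heights-half m k m/2≡k log≡ = begin
  staircase (bit m) ⌊log₂ m ⌋                             ≡⟨ cong (staircase (bit m)) log≡ ⟩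
  staircase (bit m) (suc ⌊log₂ k ⌋)                       ≡⟨ staircase-suc (bit m) ⌊log₂ k ⌋ ⟩
  map suc (staircase (bit (m / 2)) ⌊log₂ k ⌋) ∷ʳ m % 2   ≡⟨ cong (λ x → map suc (staircase (bit x) ⌊log₂ k ⌋) ∷ʳ m % 2) m/2≡k ⟩
  map suc (heights k) ∷ʳ m % 2                            ∎

heights-2* : ∀ k .{{_ : NonZero k}} → heights (2 * k) ≡ raise (heights k)
heights-2* k = trans (heights-half (2 * k) k ([2*k]/2≡k k) (⌊log₂[2*b]⌋≡1+⌊log₂b⌋ k))
                     (cong (map suc (heights k) ∷ʳ_) ([2*k]%2≡0 k))

heights-1+2* : ∀ k .{{_ : NonZero k}} → heights (1 + 2 * k) ≡ map suc (heights k) ∷ʳ 1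
heights-1+2* k = trans (heights-half (1 + 2 * k) k ([1+2*k]/2≡k k) (⌊log₂[1+2*k]⌋≡1+⌊log₂k⌋ k))
                       (cong (map suc (heights k) ∷ʳ_) ([1+2*k]%2≡1 k))

mergeHere-≡ : ∀ x zs → mergeHere x (x ∷ zs) nothing ≡ just (length zs , x , suc x ∷ zs)
mergeHere-≡ x zs with x ≟ x
... | yes _   = refl
... | no x≢x  = contradiction refl x≢x

mergeRightmost-∷ʳ-∷ʳ : ∀ xs a → mergeRightmost (xs ∷ʳ a ∷ʳ a) ≡ just (0 , a , xs ∷ʳ suc a)
mergeRightmost-∷ʳ-∷ʳ []       a = mergeHere-≡ a []
mergeRightmost-∷ʳ-∷ʳ (x ∷ xs) a = cong (mergeHere x _) (mergeRightmost-∷ʳ-∷ʳ xs a)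

raiseInfo : MergeInfo → MergeInfo
raiseInfo (p , s , ys) = suc p , suc s , raise ys

length-raise : ∀ xs → length (raise xs) ≡ suc (length xs)
length-raise xs = trans (length-++ (map suc xs)) (trans (cong (_+ 1) (length-map suc xs)) (+-comm _ 1))

mergeHere-raise : ∀ x xs r →
  mergeHere (suc x) (raise xs) (Maybe.map raiseInfo r) ≡ Maybe.map raiseInfo (mergeHere x xs r)
mergeHere-raise x xs       (just _) = refl
mergeHere-raise x []       nothing  = refl
mergeHere-raise x (y ∷ zs) nothing with x ≟ y | suc x ≟ suc y
... | yes _   | yes _       = cong (λ l → just (l , suc x , raise (suc x ∷ zs))) (length-raise zs)
... | yes x≡y | no 1+x≢1+y  = contradiction (cong suc x≡y) 1+x≢1+y
... | no x≢y  | yes 1+x≡1+y = contradiction (suc-injective 1+x≡1+y) x≢y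
... | no _    | no _        = refl

mergeRightmost-raise : ∀ xs → mergeRightmost (raise xs) ≡ Maybe.map raiseInfo (mergeRightmost xs)
mergeRightmost-raise []       = refl
mergeRightmost-raise (x ∷ xs) = trans (cong (mergeHere (suc x) (raise xs)) (mergeRightmost-raise xs))
                                      (mergeHere-raise x xs (mergeRightmost xs))

nth-++ : ∀ xs ys {i v} → nth xs i ≡ just v → nth (xs ++ ys) i ≡ just v
nth-++ (x ∷ xs) ys {zero}  eq = eq
nth-++ (x ∷ xs) ys {suc i} eq = nth-++ xs ys eq

nth-∷ʳ-length : ∀ xs v → nth (xs ∷ʳ v) (length xs) ≡ just v
nth-∷ʳ-length []       v = refl
nth-∷ʳ-length (x ∷ xs) v = nth-∷ʳ-length xs v

nth-reverse-∷ : ∀ x xs {i v} → nth (reverse xs) i ≡ just v → nth (reverse (x ∷ xs)) i ≡ just v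
nth-reverse-∷ x xs eq rewrite unfold-reverse x xs = nth-++ (reverse xs) _ eq

nth-reverse-∷-length : ∀ x xs → nth (reverse (x ∷ xs)) (length xs) ≡ just x
nth-reverse-∷-length x xs rewrite unfold-reverse x xs | sym (length-reverse xs) = nth-∷ʳ-length (reverse xs) x

mergeRightmost-nth : ∀ xs {p s ys} → mergeRightmost xs ≡ just (p , s , ys) → nth (reverse ys) p ≡ just (suc s)
mergeRightmost-nth (x ∷ y ∷ zs) eq with mergeRightmost (y ∷ zs) in eq′
mergeRightmost-nth (x ∷ y ∷ zs) refl | just (_ , _ , ys) = nth-reverse-∷ x ys (mergeRightmost-nth (y ∷ zs) eq′)
mergeRightmost-nth (x ∷ y ∷ zs) eq   | nothing with x ≟ y
mergeRightmost-nth (x ∷ y ∷ zs) refl | nothing | yes refl = nth-reverse-∷-length (suc x) zs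

-- M is always suc m; it is a separate index so that the odd case can be stated at 2 * suc k.
data AppendStep (m M : ℕ) : Set where
  no-merge : IsPowerOfTwo M → appendMerge (heights m) ≡ nothing →
             heights M ≡ heights m ∷ʳ 0 → AppendStep m M
  merge    : ¬ IsPowerOfTwo M → ∀ j → LowestOneBit M j →
             appendMerge (heights m) ≡ just (j , j , heights M) → AppendStep m M

appendStep-2* : ∀ k .{{_ : NonZero k}} → AppendStep (2 * k) (1 + 2 * k)
appendStep-2* k = merge (¬isPowerOfTwo-1+2* k) 0 (lowestOneBit-1+2* k) (begin
  mergeRightmost (heights (2 * k) ∷ʳ 0)          ≡⟨ cong (λ xs → mergeRightmost (xs ∷ʳ 0)) (heights-2* k) ⟩
  mergeRightmost (map suc (heights k) ∷ʳ 0 ∷ʳ 0) ≡⟨ mergeRightmost-∷ʳ-∷ʳ (map suc (heights k)) 0 ⟩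
  just (0 , 0 , map suc (heights k) ∷ʳ 1)        ≡⟨ cong (λ xs → just (0 , 0 , xs)) (sym (heights-1+2* k)) ⟩
  just (0 , 0 , heights (1 + 2 * k))             ∎)

heights-1+2*-∷ʳ : ∀ k .{{_ : NonZero k}} → heights (1 + 2 * k) ∷ʳ 0 ≡ raise (heights k ∷ʳ 0)
heights-1+2*-∷ʳ k = cong (_∷ʳ 0) (trans (heights-1+2* k) (sym (map-++ suc (heights k) [ 0 ])))

appendMerge-1+2* : ∀ k .{{_ : NonZero k}} →
                   appendMerge (heights (1 + 2 * k)) ≡ Maybe.map raiseInfo (appendMerge (heights k))
appendMerge-1+2* k = trans (cong mergeRightmost (heights-1+2*-∷ʳ k)) (mergeRightmost-raise (heights k ∷ʳ 0))

appendStep-1+2* : ∀ k .{{_ : NonZero k}} → AppendStep k (suc k) → AppendStep (1 + 2 * k) (2 * suc k)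
appendStep-1+2* k (no-merge pow e h) =
  no-merge (isPowerOfTwo-2* pow) (trans (appendMerge-1+2* k) (cong (Maybe.map raiseInfo) e)) (begin
  heights (2 * suc k)         ≡⟨ heights-2* (suc k) ⟩
  raise (heights (suc k))     ≡⟨ cong raise h ⟩
  raise (heights k ∷ʳ 0)      ≡⟨ sym (heights-1+2*-∷ʳ k) ⟩
  heights (1 + 2 * k) ∷ʳ 0    ∎)
appendStep-1+2* k (merge ¬pow j low e) =
  merge (¬pow ∘ isPowerOfTwo-2*⁻¹) (suc j) (lowestOneBit-2* low) (begin
  appendMerge (heights (1 + 2 * k))                  ≡⟨ appendMerge-1+2* k ⟩
  Maybe.map raiseInfo (appendMerge (heights k))      ≡⟨ cong (Maybe.map raiseInfo) e ⟩
  just (suc j , suc j , raise (heights (suc k)))     ≡⟨ cong (λ xs → just (suc j , suc j , xs)) (sym (heights-2* (suc k))) ⟩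
  just (suc j , suc j , heights (2 * suc k))         ∎)

appendStep : ∀ {m} → Positive m → AppendStep m (suc m)
appendStep one          = no-merge (1 , refl) refl refl
appendStep (even {k} p) = appendStep-2* k {{positive⇒nonZero p}}
appendStep (odd {k} p)  = subst (AppendStep (1 + 2 * k)) (*-suc 2 k)
                                (appendStep-1+2* k {{positive⇒nonZero p}} (appendStep p))

append-heights : ∀ {m M} → AppendStep m M → append (heights m) ≡ heights M
append-heights {m} (no-merge _ e h)  = trans (cong (resultOf (heights m)) e) (sym h)
append-heights {m} (merge _ _ _ e)   = cong (resultOf (heights m)) e

S≡heights : ∀ n → S n ≡ heights (suc n)
S≡heights zero    = refl
S≡heights (suc n) = trans (cong append (S≡heights n)) (append-heights (appendStep (positive n)))

staircase-gaps : ∀ {c} → (∀ i → c i ≤ 1) → ∀ t → Linked (λ a b → b ≤ a × a ≤ b + 2) (staircase c t)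
staircase-gaps {c} c≤1 t = applyDownFrom⁺₂ (λ i → c i + i) t (λ i → lower i , upper i)
  where
  lower : ∀ i → c i + i ≤ c (suc i) + suc i
  lower i = ≤-trans (+-monoˡ-≤ i (c≤1 i)) (m≤n+m (suc i) (c (suc i)))
  upper : ∀ i → c (suc i) + suc i ≤ (c i + i) + 2
  upper i = ≤-trans (+-monoˡ-≤ (suc i) (c≤1 (suc i)))
                    (subst (_≤ (c i + i) + 2) (+-comm i 2) (+-monoˡ-≤ 2 (m≤n+m i (c i))))

countEq-++ : ∀ h xs ys → countEq h (xs ++ ys) ≡ countEq h xs + countEq h ys
countEq-++ h []       ys = refl
countEq-++ h (x ∷ xs) ys with x ≟ h
... | yes _ = cong suc (countEq-++ h xs ys)
... | no  _ = countEq-++ h xs ys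

countEq-map-suc : ∀ h xs → countEq (suc h) (map suc xs) ≡ countEq h xs
countEq-map-suc h []       = refl
countEq-map-suc h (x ∷ xs) with x ≟ h | suc x ≟ suc h
... | yes _   | yes _       = cong suc (countEq-map-suc h xs)
... | yes x≡h | no 1+x≢1+h  = contradiction (cong suc x≡h) 1+x≢1+h
... | no x≢h  | yes 1+x≡1+h = contradiction (suc-injective 1+x≡1+h) x≢h
... | no _    | no _        = countEq-map-suc h xs

countEq-0-map-suc : ∀ xs → countEq 0 (map suc xs) ≡ 0
countEq-0-map-suc []       = refl
countEq-0-map-suc (x ∷ xs) = countEq-0-map-suc xs

countEq-[x]≤1 : ∀ h x → countEq h [ x ] ≤ 1
countEq-[x]≤1 h x with x ≟ h
... | yes _ = s≤s z≤n
... | no  _ = z≤n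

countEq-[x]≡0 : ∀ {h x} → x ≢ h → countEq h [ x ] ≡ 0
countEq-[x]≡0 {h} {x} x≢h with x ≟ h
... | yes x≡h = contradiction x≡h x≢h
... | no  _   = refl

countEq-0-map-suc-∷ʳ : ∀ xs b → countEq 0 (map suc xs ∷ʳ b) ≤ 1
countEq-0-map-suc-∷ʳ xs b rewrite countEq-++ 0 (map suc xs) [ b ] | countEq-0-map-suc xs = countEq-[x]≤1 0 b

countEq-map-suc-∷ʳ : ∀ xs {b} → b ≤ 1 → countEq 0 xs ≤ 1 → (∀ h → countEq h xs ≤ 2) →
                     ∀ h → countEq h (map suc xs ∷ʳ b) ≤ 2
countEq-map-suc-∷ʳ xs {b} b≤1 zeros≤1 counts≤2 zero = ≤-trans (countEq-0-map-suc-∷ʳ xs b) (s≤s z≤n)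
countEq-map-suc-∷ʳ xs {b} b≤1 zeros≤1 counts≤2 (suc h)
  rewrite countEq-++ (suc h) (map suc xs) [ b ] | countEq-map-suc h xs = bound h
  where
  bound : ∀ h → countEq h xs + countEq (suc h) [ b ] ≤ 2
  bound zero    = +-mono-≤ zeros≤1 (countEq-[x]≤1 1 b)
  bound (suc h) = +-mono-≤ (counts≤2 (suc h)) (≤-reflexive (countEq-[x]≡0 b≢2+h))
    where
    b≢2+h : b ≢ 2 + h
    b≢2+h b≡2+h = contradiction (subst (_≤ 1) b≡2+h b≤1) λ { (s≤s ()) }

staircase-countEq-0 : ∀ c t → countEq 0 (staircase c t) ≤ 1
staircase-countEq-0 c zero    = z≤n
staircase-countEq-0 c (suc t) = subst (λ xs → countEq 0 xs ≤ 1) (sym (staircase-suc c t))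
                                     (countEq-0-map-suc-∷ʳ (staircase (c ∘ suc) t) (c 0))

staircase-countEq : ∀ {c} → (∀ i → c i ≤ 1) → ∀ t h → countEq h (staircase c t) ≤ 2
staircase-countEq c≤1 zero    h = z≤n
staircase-countEq {c} c≤1 (suc t) h =
  subst (λ xs → countEq h xs ≤ 2) (sym (staircase-suc c t))
        (countEq-map-suc-∷ʳ (staircase (c ∘ suc) t) (c≤1 0) (staircase-countEq-0 (c ∘ suc) t)
                        (staircase-countEq (c≤1 ∘ suc) t) h)

length-S : ∀ n → length (S n) ≡ ⌊log₂ (suc n) ⌋
length-S n = trans (cong length (S≡heights n)) (length-applyDownFrom _ _)

reverse-S : ∀ n → reverse (S n) ≡ applyUpTo (λ i → bit (suc n) i + i) ⌊log₂ (suc n) ⌋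
reverse-S n = trans (cong reverse (S≡heights n)) (reverse-applyDownFrom _ _)

S-gaps : ∀ n → Linked (λ a b → b ≤ a × a ≤ b + 2) (S n)
S-gaps n = subst (Linked _) (sym (S≡heights n)) (staircase-gaps (bit≤1 (suc n)) ⌊log₂ (suc n) ⌋)

S-countEq : ∀ n h → countEq h (S n) ≤ 2
S-countEq n h = subst (λ xs → countEq h xs ≤ 2) (sym (S≡heights n))
                      (staircase-countEq (bit≤1 (suc n)) ⌊log₂ (suc n) ⌋ h)

nthAppendMerge-heights : ∀ n → nthAppendMerge (suc n) ≡ appendMerge (heights (suc n))
nthAppendMerge-heights n = cong appendMerge (S≡heights n)

nthAppendMerge≡nothing⇔ : ∀ n → nthAppendMerge (suc n) ≡ nothing ⇔ IsPowerOfTwo (2 + n)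
nthAppendMerge≡nothing⇔ n with appendStep (positive n)
... | no-merge pow e _ = mk⇔ (λ _ → pow) (λ _ → trans (nthAppendMerge-heights n) e)
... | merge ¬pow _ _ e = mk⇔ (λ none → contradiction (trans (sym none) (trans (nthAppendMerge-heights n) e)) λ ())
                             (λ pow → contradiction pow ¬pow)

nthAppendMerge-lowestOneBit : ∀ n → ¬ IsPowerOfTwo (2 + n) → ∀ j → LowestOneBit (2 + n) j →
                              nthAppendMerge (suc n) ≡ just (j , j , S (suc n))
nthAppendMerge-lowestOneBit n ¬pow j low with appendStep (positive n)
... | no-merge pow _ _ = contradiction pow ¬pow
... | merge _ i lowᵢ e with refl ← lowestOneBit-unique lowᵢ low = begin
  nthAppendMerge (suc n)               ≡⟨ nthAppendMerge-heights n ⟩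
  appendMerge (heights (suc n))        ≡⟨ e ⟩
  just (j , j , heights (2 + n))       ≡⟨ cong (λ xs → just (j , j , xs)) (sym (S≡heights (suc n))) ⟩
  just (j , j , S (suc n))             ∎

lemma3 : (n : ℕ) → 1 ≤ n →
    -- (1) number of mountains
    (length (S n) ≡ ⌊log₂ (suc n) ⌋)
    -- (2) heights enumerated right to left: s_i = b_i + i for 0 ≤ i < t
    × (reverse (S n) ≡ applyUpTo (λ i → bit (suc n) i + i) ⌊log₂ (suc n) ⌋)
    -- (3) merge step of the n-th append
    × ((nthAppendMerge n ≡ nothing ⇔ IsPowerOfTwo (suc n))
       × (¬ IsPowerOfTwo (suc n) → (j : ℕ) → LowestOneBit (suc n) j →
            (nthAppendMerge n ≡ just (j , j , S n))
            × (nth (reverse (S n)) j ≡ just (suc j))))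
    -- (4) weakly decreasing, at most two of each height, gaps 0, 1 or 2
    × Linked _≥_ (S n)
    × ((h : ℕ) → countEq h (S n) ≤ 2)
    × Linked (λ a b → b ≤ a × a ≤ b + 2) (S n)
lemma3 (suc n) _ =
  length-S (suc n) ,
  reverse-S (suc n) ,
  (nthAppendMerge≡nothing⇔ n , merges) ,
  Linked.map proj₁ (S-gaps (suc n)) ,
  S-countEq (suc n) ,
  S-gaps (suc n)
  where
  merges : ¬ IsPowerOfTwo (2 + n) → ∀ j → LowestOneBit (2 + n) j →
           (nthAppendMerge (suc n) ≡ just (j , j , S (suc n))) × (nth (reverse (S (suc n))) j ≡ just (suc j))
  merges ¬pow j low = merged , mergeRightmost-nth (S n ∷ʳ 0) merged
    where
    merged : nthAppendMerge (suc n) ≡ just (j , j , S (suc n))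
    merged = nthAppendMerge-lowestOneBit n ¬pow j low
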